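{- Let $m\ge 3$, $n\ge 2$, let $G$ be either $P_n\times K_m$ or $C_n\times K_m$, let $i\in[n]$, and let $A=\{a,b\}$ be a set of two distinct vertices of $G$. Then $A$ dominates the column $X_i$ if and only if both of the following hold: \begin{enumerate} \item $A \subseteq X_{i-1}\cup X_i\cup X_{i+1}$ and $A \not\subseteq X_i$; \item one of $a,b$ lies in $X_i$ and the other lies in $X_{i-1}\cup X_{i+1}$ if and only if $a$ and $b$ have the same second coordinate (i.e. lie in the same row). \end{enumerate}
   Context: $[n]=\{1,\dots,n\}$. $P_n$ is the path on $[n]$ with edges $\{i,i+1\}$; $C_n$ is the cycle on $[n]$ with edges $\{i,i+1\}$ and $\{n,1\}$ ($C_2$ is understood as the single edge $\{1,2\}$); $K_m$ is the complete graph on $[m]$. The direct product $G\times H$ has vertex set $V(G)\times V(H)$ with $(g_1,h_1)\sim(g_2,h_2)$ iff $g_1g_2\in E(G)$ and $h_1h_2\in E(H)$. For $i\in[n]$, the column is $X_i=\{(i,j):j\in[m]\}$ and for $j\in[m]$ the row is $R_j=\{(i,j): i\in[n]\}$. For $P_n\times K_m$ set $X_0=X_{n+1}=\emptyset$; for $C_n\times K_m$ set $X_0=X_n$ and $X_{n+1}=X_1$. A set $A$ dominates a set $B$ if every vertex of $B$ is in $A$ or adjacent to a vertex of $A$. -}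

module Defs where

open import Data.Nat using (ℕ; zero; suc; _≤_; _∸_; _+_)
open import Data.Product using (_×_; _,_; proj₁; proj₂)
open import Data.Sum using (_⊎_)
open import Relation.Binary.PropositionalEquality using (_≡_; _≢_)

data Kind : Set where
  path cycle : Kind

Vertex : Set
Vertex = ℕ × ℕ

IsVertex : ℕ → ℕ → Vertex → Set
IsVertex n m (i , j) = (1 ≤ i × i ≤ n) × (1 ≤ j × j ≤ m)

PathAdj : ℕ → ℕ → ℕ → Set
PathAdj n i i' = (1 ≤ i × i ≤ n) × (1 ≤ i' × i' ≤ n) × (i' ≡ suc i ⊎ i ≡ suc i')

-- Edges of C_n: those of P_n plus {n, 1}  (for n = 2 this is the single edge {1,2})
CycleAdj : ℕ → ℕ → ℕ → Set
CycleAdj n i i' = PathAdj n i i' ⊎ ((i ≡ n × i' ≡ 1) ⊎ (i ≡ 1 × i' ≡ n))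

FactorAdj : Kind → ℕ → ℕ → ℕ → Set
FactorAdj path  = PathAdj
FactorAdj cycle = CycleAdj

CompleteAdj : ℕ → ℕ → ℕ → Set
CompleteAdj m j j' = (1 ≤ j × j ≤ m) × (1 ≤ j' × j' ≤ m) × j ≢ j'

Adj : Kind → ℕ → ℕ → Vertex → Vertex → Set
Adj G n m (i , j) (i' , j') = FactorAdj G n i i' × CompleteAdj m j j'

-- Membership in the column X_k for k ∈ {0, …, n+1}, with X_k = {(k , j) : j ∈ [m]}.
-- For P_n × K_m: X_0 = X_{n+1} = ∅ (no vertex has first coordinate 0 or n+1).
-- For C_n × K_m: X_0 = X_n and X_{n+1} = X_1.
InCol : Kind → ℕ → ℕ → ℕ → Vertex → Set
InCol path  n m k v = IsVertex n m v × proj₁ v ≡ k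
InCol cycle n m k v =
  IsVertex n m v × (proj₁ v ≡ k ⊎ ((k ≡ 0 × proj₁ v ≡ n) ⊎ (k ≡ suc n × proj₁ v ≡ 1)))

InNbrCols : Kind → ℕ → ℕ → ℕ → Vertex → Set
InNbrCols G n m i v = InCol G n m (i ∸ 1) v ⊎ InCol G n m (suc i) v

InCloseCols : Kind → ℕ → ℕ → ℕ → Vertex → Set
InCloseCols G n m i v = InNbrCols G n m i v ⊎ InCol G n m i v

DominatesCol : Kind → ℕ → ℕ → Vertex → Vertex → ℕ → Set
DominatesCol G n m a b i =
  ∀ v → InCol G n m i v → (v ≡ a ⊎ v ≡ b) ⊎ (Adj G n m a v ⊎ Adj G n m b v)

{-# OPTIONS --safe #-}

-- A vertex (p , q) dominates the cell (i , j) of X_i iff either p = i and q = j, or p is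
-- adjacent to i in the factor graph and q ≠ j.  So a vertex of X_i covers only its own row,
-- a vertex of X_{i-1} ∪ X_{i+1} covers every row except its own, and any other vertex covers
-- nothing.  With at least three rows, two vertices therefore cover all of X_i exactly when one
-- lies in X_i and the other in a neighbouring column of the same row, or both lie in
-- neighbouring columns in different rows, which is the stated criterion.

module Submission where

open import Defs
open import Data.Empty using (⊥; ⊥-elim)
open import Data.Nat using (ℕ; suc; _≤_; z≤n; s≤s; _≟_; _≤?_)
open import Data.Nat.Properties using (1+n≰n; n≤1+n; ≤-trans)
open import Data.Product using (_×_; _,_; proj₁; proj₂; ∃; ∃-syntax)
open import Data.Sum using (_⊎_; inj₁; inj₂; [_,_]; map; swap)
open import Data.Sum.Function.Propositional using (_⊎-⇔_)
open import Function using (_∘_; id; const)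
open import Function.Bundles using (_⇔_; mk⇔; Equivalence)
open import Function.Properties.Equivalence using () renaming (sym to ⇔-sym; trans to ⇔-trans)
open import Relation.Binary.PropositionalEquality using (_≡_; _≢_; refl; sym)
open import Relation.Nullary using (¬_; Dec; yes; no)
open import Relation.Nullary.Decidable using (_×-dec_; _⊎-dec_; toSum)

open Equivalence using (to; from)

⊎-interchange : ∀ {a b c d} {A : Set a} {B : Set b} {C : Set c} {D : Set d} →
                (A ⊎ B) ⊎ (C ⊎ D) → (A ⊎ C) ⊎ (B ⊎ D)
⊎-interchange = [ map inj₁ inj₁ , map inj₂ inj₂ ]

FactorAdj-irrefl : ∀ G {n x} → 2 ≤ n → ¬ FactorAdj G n x x
FactorAdj-irrefl path  _ (_ , _ , inj₁ ())
FactorAdj-irrefl path  _ (_ , _ , inj₂ ())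
FactorAdj-irrefl cycle _ (inj₁ (_ , _ , inj₁ ()))
FactorAdj-irrefl cycle _ (inj₁ (_ , _ , inj₂ ()))
FactorAdj-irrefl cycle (s≤s ()) (inj₂ (inj₁ (refl , refl)))
FactorAdj-irrefl cycle (s≤s ()) (inj₂ (inj₂ (refl , refl)))

FactorAdj-dec : ∀ G n x y → Dec (FactorAdj G n x y)
FactorAdj-dec path n x y =
  ((1 ≤? x) ×-dec (x ≤? n)) ×-dec ((1 ≤? y) ×-dec (y ≤? n)) ×-dec ((y ≟ suc x) ⊎-dec (x ≟ suc y))
FactorAdj-dec cycle n x y =
  FactorAdj-dec path n x y ⊎-dec ((x ≟ n) ×-dec (y ≟ 1)) ⊎-dec ((x ≟ 1) ×-dec (y ≟ n))

InCol-isVertex : ∀ G {n m k v} → InCol G n m k v → IsVertex n m v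
InCol-isVertex path  = proj₁
InCol-isVertex cycle = proj₁

InCol⇒≡ : ∀ G {n m i v} → 1 ≤ i → i ≤ n → InCol G n m i v → proj₁ v ≡ i
InCol⇒≡ path  _ _ (_ , e) = e
InCol⇒≡ cycle _ _ (_ , inj₁ e) = e
InCol⇒≡ cycle () _ (_ , inj₂ (inj₁ (refl , _)))
InCol⇒≡ cycle _ i≤n (_ , inj₂ (inj₂ (refl , _))) = ⊥-elim (1+n≰n i≤n)

≡⇒InCol : ∀ G {n m i v} → IsVertex n m v → proj₁ v ≡ i → InCol G n m i v
≡⇒InCol path  v∈ e = v∈ , e
≡⇒InCol cycle v∈ e = v∈ , inj₁ e

InNbrCols⇒FactorAdj : ∀ G {n m i x y} → 1 ≤ i → i ≤ n →
                      InNbrCols G n m i (x , y) → FactorAdj G n x i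
InNbrCols⇒FactorAdj path  (s≤s z≤n) i≤n (inj₁ ((x∈ , _) , refl)) = x∈ , (s≤s z≤n , i≤n) , inj₁ refl
InNbrCols⇒FactorAdj path  1≤i i≤n (inj₂ ((x∈ , _) , refl)) = x∈ , (1≤i , i≤n) , inj₂ refl
InNbrCols⇒FactorAdj cycle (s≤s z≤n) i≤n (inj₁ ((x∈ , _) , inj₁ refl)) = inj₁ (x∈ , (s≤s z≤n , i≤n) , inj₁ refl)
InNbrCols⇒FactorAdj cycle (s≤s z≤n) i≤n (inj₁ (_ , inj₂ (inj₁ (refl , x≡n)))) = inj₂ (inj₁ (x≡n , refl))
InNbrCols⇒FactorAdj cycle (s≤s z≤n) i≤n (inj₁ (_ , inj₂ (inj₂ (refl , _)))) =
  ⊥-elim (1+n≰n (≤-trans (n≤1+n _) i≤n))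
InNbrCols⇒FactorAdj cycle 1≤i i≤n (inj₂ ((x∈ , _) , inj₁ refl)) = inj₁ (x∈ , (1≤i , i≤n) , inj₂ refl)
InNbrCols⇒FactorAdj cycle _ _ (inj₂ (_ , inj₂ (inj₁ (() , _))))
InNbrCols⇒FactorAdj cycle _ _ (inj₂ (_ , inj₂ (inj₂ (refl , x≡1)))) = inj₂ (inj₂ (x≡1 , refl))

FactorAdj⇒InNbrCols : ∀ G {n m i x y} → IsVertex n m (x , y) →
                      FactorAdj G n x i → InNbrCols G n m i (x , y)
FactorAdj⇒InNbrCols path  v∈ (_ , _ , inj₁ refl) = inj₁ (v∈ , refl)
FactorAdj⇒InNbrCols path  v∈ (_ , _ , inj₂ refl) = inj₂ (v∈ , refl)
FactorAdj⇒InNbrCols cycle v∈ (inj₁ (_ , _ , inj₁ refl)) = inj₁ (v∈ , inj₁ refl)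
FactorAdj⇒InNbrCols cycle v∈ (inj₁ (_ , _ , inj₂ refl)) = inj₂ (v∈ , inj₁ refl)
FactorAdj⇒InNbrCols cycle v∈ (inj₂ (inj₁ (refl , refl))) = inj₁ (v∈ , inj₂ (inj₁ (refl , refl)))
FactorAdj⇒InNbrCols cycle v∈ (inj₂ (inj₂ (refl , refl))) = inj₂ (v∈ , inj₂ (inj₂ (refl , refl)))

-- Where a vertex lies relative to X_i: in X_i, in X_{i-1} ∪ X_{i+1}, or in neither.
data Placement : Set where
  inside beside outside : Placement

-- The rows j whose cell (i , j) is dominated by a vertex in row q with the given placement.
Covers : Placement → ℕ → ℕ → Set
Covers inside  q j = q ≡ j
Covers beside  q j = q ≢ j
Covers outside _ _ = ⊥

CoverAllRows : ℕ → Placement → ℕ → Placement → ℕ → Set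
CoverAllRows m s q s′ q′ = ∀ j → 1 ≤ j × j ≤ m → Covers s q j ⊎ Covers s′ q′ j

Covering : Placement → Placement → ℕ → ℕ → Set
Covering inside beside  q q′ = q ≡ q′
Covering beside inside  q q′ = q ≡ q′
Covering beside beside  q q′ = q ≢ q′
Covering _      _       _ _  = ⊥

fresh-row : ∀ {m} → 3 ≤ m → (q q′ : ℕ) → ∃[ j ] (1 ≤ j × j ≤ m) × q ≢ j × q′ ≢ j
fresh-row 3≤m q q′ with q ≟ 1 | q′ ≟ 1 | q ≟ 2 | q′ ≟ 2
... | no q≢1 | no q′≢1 | _        | _         = 1 , (s≤s z≤n , ≤-trans (s≤s z≤n) 3≤m) , q≢1 , q′≢1
... | _      | _       | no q≢2   | no q′≢2   = 2 , (s≤s z≤n , ≤-trans (s≤s (s≤s z≤n)) 3≤m) , q≢2 , q′≢2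
... | yes refl | _     | yes ()   | _
... | _ | yes refl     | _        | yes ()
... | yes refl | _     | _        | yes refl  = 3 , (s≤s z≤n , 3≤m) , (λ ()) , (λ ())
... | _ | yes refl     | yes refl | _         = 3 , (s≤s z≤n , 3≤m) , (λ ()) , (λ ())

CoverAllRows⇒Covering : ∀ {m} → 3 ≤ m → ∀ s s′ {q q′} → 1 ≤ q × q ≤ m → 1 ≤ q′ × q′ ≤ m →
                        CoverAllRows m s q s′ q′ → Covering s s′ q q′
CoverAllRows⇒Covering 3≤m inside  inside  {q} {q′} _ _ cover
  with j , j∈ , q≢j , q′≢j ← fresh-row 3≤m q q′ = [ q≢j , q′≢j ] (cover j j∈)
CoverAllRows⇒Covering _ inside  beside  {q′ = q′} _ q′∈ cover =
  [ id , (λ q′≢q′ → ⊥-elim (q′≢q′ refl)) ] (cover q′ q′∈)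
CoverAllRows⇒Covering 3≤m inside  outside {q} _ _ cover
  with j , j∈ , q≢j , _ ← fresh-row 3≤m q q = [ q≢j , (λ ()) ] (cover j j∈)
CoverAllRows⇒Covering _ beside  inside  {q} q∈ _ cover =
  [ (λ q≢q → ⊥-elim (q≢q refl)) , sym ] (cover q q∈)
CoverAllRows⇒Covering _ beside  beside  {q} q∈ _ cover refl =
  [ (λ q≢q → q≢q refl) , (λ q≢q → q≢q refl) ] (cover q q∈)
CoverAllRows⇒Covering _ beside  outside {q} q∈ _ cover =
  [ (λ q≢q → q≢q refl) , (λ ()) ] (cover q q∈)
CoverAllRows⇒Covering 3≤m outside inside  {q′ = q′} _ _ cover
  with j , j∈ , q′≢j , _ ← fresh-row 3≤m q′ q′ = [ (λ ()) , q′≢j ] (cover j j∈)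
CoverAllRows⇒Covering _ outside beside  {q′ = q′} _ q′∈ cover =
  [ (λ ()) , (λ q′≢q′ → q′≢q′ refl) ] (cover q′ q′∈)
CoverAllRows⇒Covering _ outside outside q∈ _ cover = [ (λ ()) , (λ ()) ] (cover _ q∈)

Covering⇒CoverAllRows : ∀ {m} s s′ {q q′} → Covering s s′ q q′ → CoverAllRows m s q s′ q′
Covering⇒CoverAllRows inside beside {q} refl j _ = toSum (q ≟ j)
Covering⇒CoverAllRows beside inside {q} refl j _ = swap (toSum (q ≟ j))
Covering⇒CoverAllRows beside beside {q} q≢q′ j _ with q ≟ j
... | yes refl = inj₂ (q≢q′ ∘ sym)
... | no q≢j   = inj₁ q≢j

CoverAllRows⇔Covering : ∀ {m} → 3 ≤ m → ∀ s s′ {q q′} → 1 ≤ q × q ≤ m → 1 ≤ q′ × q′ ≤ m →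
                        CoverAllRows m s q s′ q′ ⇔ Covering s s′ q q′
CoverAllRows⇔Covering 3≤m s s′ q∈ q′∈ =
  mk⇔ (CoverAllRows⇒Covering 3≤m s s′ q∈ q′∈) (Covering⇒CoverAllRows s s′)

Dominates : Kind → ℕ → ℕ → Vertex → Vertex → Set
Dominates G n m x v = v ≡ x ⊎ Adj G n m x v

Criterion : Kind → ℕ → ℕ → ℕ → Vertex → Vertex → Set
Criterion G n m i a b =
  (InCloseCols G n m i a × InCloseCols G n m i b)
  × ¬ (InCol G n m i a × InCol G n m i b)
  × (((InCol G n m i a × InNbrCols G n m i b) ⊎ (InCol G n m i b × InNbrCols G n m i a))
      ⇔ (proj₂ a ≡ proj₂ b))

module Relative (G : Kind) {n} (2≤n : 2 ≤ n) {i} (1≤i : 1 ≤ i) (i≤n : i ≤ n) where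

  data Placed (p : ℕ) : Placement → Set where
    inside  : p ≡ i → Placed p inside
    beside  : FactorAdj G n p i → Placed p beside
    outside : p ≢ i → ¬ FactorAdj G n p i → Placed p outside

  placed : ∀ p → ∃ (Placed p)
  placed p with p ≟ i | FactorAdj-dec G n p i
  ... | yes p≡i | _        = inside , inside p≡i
  ... | no _    | yes adj  = beside , beside adj
  ... | no p≢i  | no ¬adj  = outside , outside p≢i ¬adj

  irrefl : ∀ {p} → p ≡ i → ¬ FactorAdj G n p i
  irrefl refl = FactorAdj-irrefl G 2≤n

  InCol⇒inside : ∀ {m p q s} → Placed p s → InCol G n m i (p , q) → s ≡ inside
  InCol⇒inside (inside _)        _   = refl
  InCol⇒inside (beside adj)      p∈X = ⊥-elim (irrefl (InCol⇒≡ G 1≤i i≤n p∈X) adj)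
  InCol⇒inside (outside p≢i _)   p∈X = ⊥-elim (p≢i (InCol⇒≡ G 1≤i i≤n p∈X))

  InNbrCols⇒beside : ∀ {m p q s} → Placed p s → InNbrCols G n m i (p , q) → s ≡ beside
  InNbrCols⇒beside (inside p≡i)     p∈N = ⊥-elim (irrefl p≡i (InNbrCols⇒FactorAdj G 1≤i i≤n p∈N))
  InNbrCols⇒beside (beside _)       _   = refl
  InNbrCols⇒beside (outside _ ¬adj) p∈N = ⊥-elim (¬adj (InNbrCols⇒FactorAdj G 1≤i i≤n p∈N))

  InCloseCols⇒beside⊎inside : ∀ {m p q s} → Placed p s → InCloseCols G n m i (p , q) →
                              s ≡ beside ⊎ s ≡ inside
  InCloseCols⇒beside⊎inside placement = map (InNbrCols⇒beside placement) (InCol⇒inside placement)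

  placed-beside⇒¬InCol : ∀ {m p q} → Placed p beside → ¬ InCol G n m i (p , q)
  placed-beside⇒¬InCol placement p∈X with () ← InCol⇒inside placement p∈X

  placed-inside⇒InCol : ∀ {m p q} → IsVertex n m (p , q) → Placed p inside → InCol G n m i (p , q)
  placed-inside⇒InCol v∈ (inside p≡i) = ≡⇒InCol G v∈ p≡i

  placed-beside⇒InNbrCols : ∀ {m p q} → IsVertex n m (p , q) → Placed p beside → InNbrCols G n m i (p , q)
  placed-beside⇒InNbrCols v∈ (beside adj) = FactorAdj⇒InNbrCols G v∈ adj

  Dominates⇔Covers : ∀ {m p q j s} → 1 ≤ q × q ≤ m → 1 ≤ j × j ≤ m → Placed p s →
                     Dominates G n m (p , q) (i , j) ⇔ Covers s q j
  Dominates⇔Covers _ _ (inside refl) = mk⇔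
    (λ { (inj₁ refl) → refl ; (inj₂ (adj , _)) → ⊥-elim (irrefl refl adj) })
    (λ { refl → inj₁ refl })
  Dominates⇔Covers q∈ j∈ (beside adj) = mk⇔
    (λ { (inj₁ refl) → ⊥-elim (irrefl refl adj) ; (inj₂ (_ , _ , _ , q≢j)) → q≢j })
    (λ q≢j → inj₂ (adj , q∈ , j∈ , q≢j))
  Dominates⇔Covers _ _ (outside p≢i ¬adj) = mk⇔
    (λ { (inj₁ refl) → p≢i refl ; (inj₂ (adj , _)) → ¬adj adj })
    (λ ())

  DominatesCol⇔CoverAllRows : ∀ {m p q p′ q′ s s′} → IsVertex n m (p , q) → IsVertex n m (p′ , q′) →
                              Placed p s → Placed p′ s′ →
                              DominatesCol G n m (p , q) (p′ , q′) i ⇔ CoverAllRows m s q s′ q′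
  DominatesCol⇔CoverAllRows {m} {p} {q} {p′} {q′} {s} {s′} (_ , q∈) (_ , q′∈) placement placement′ =
    mk⇔ cover dominate
    where
    cell : ∀ {j} → 1 ≤ j × j ≤ m →
           (Dominates G n m (p , q) (i , j) ⊎ Dominates G n m (p′ , q′) (i , j)) ⇔ (Covers s q j ⊎ Covers s′ q′ j)
    cell j∈ = Dominates⇔Covers q∈ j∈ placement ⊎-⇔ Dominates⇔Covers q′∈ j∈ placement′

    cover : DominatesCol G n m (p , q) (p′ , q′) i → CoverAllRows m s q s′ q′
    cover dom j j∈ = to (cell j∈) (⊎-interchange (dom (i , j) (≡⇒InCol G ((1≤i , i≤n) , j∈) refl)))

    dominate : CoverAllRows m s q s′ q′ → DominatesCol G n m (p , q) (p′ , q′) i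
    dominate rows (x , j) v∈X with refl ← InCol⇒≡ G 1≤i i≤n v∈X =
      ⊎-interchange (from (cell j∈) (rows j j∈))
      where
      j∈ : 1 ≤ j × j ≤ m
      j∈ = proj₂ (InCol-isVertex G v∈X)

  Criterion⇒Covering : ∀ {m p q p′ q′ s s′} → IsVertex n m (p , q) → IsVertex n m (p′ , q′) →
                       Placed p s → Placed p′ s′ →
                       Criterion G n m i (p , q) (p′ , q′) → Covering s s′ q q′
  Criterion⇒Covering a∈ b∈ placement placement′ ((a-close , b-close) , ¬both-inside , same-row)
    with InCloseCols⇒beside⊎inside placement a-close | InCloseCols⇒beside⊎inside placement′ b-close
  ... | inj₂ refl | inj₂ refl =
    ⊥-elim (¬both-inside (placed-inside⇒InCol a∈ placement , placed-inside⇒InCol b∈ placement′))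
  ... | inj₂ refl | inj₁ refl =
    to same-row (inj₁ (placed-inside⇒InCol a∈ placement , placed-beside⇒InNbrCols b∈ placement′))
  ... | inj₁ refl | inj₂ refl =
    to same-row (inj₂ (placed-inside⇒InCol b∈ placement′ , placed-beside⇒InNbrCols a∈ placement))
  ... | inj₁ refl | inj₁ refl =
    [ placed-beside⇒¬InCol placement ∘ proj₁ , placed-beside⇒¬InCol placement′ ∘ proj₁ ] ∘ from same-row

  Covering⇒Criterion : ∀ {m p q p′ q′ s s′} → IsVertex n m (p , q) → IsVertex n m (p′ , q′) →
                       Placed p s → Placed p′ s′ →
                       Covering s s′ q q′ → Criterion G n m i (p , q) (p′ , q′)
  Covering⇒Criterion a∈ b∈ placement@(inside _) placement′@(beside _) q≡q′ =
    (inj₂ (placed-inside⇒InCol a∈ placement) , inj₁ (placed-beside⇒InNbrCols b∈ placement′)) ,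
    placed-beside⇒¬InCol placement′ ∘ proj₂ ,
    mk⇔ (const q≡q′)
        (const (inj₁ (placed-inside⇒InCol a∈ placement , placed-beside⇒InNbrCols b∈ placement′)))
  Covering⇒Criterion a∈ b∈ placement@(beside _) placement′@(inside _) q≡q′ =
    (inj₁ (placed-beside⇒InNbrCols a∈ placement) , inj₂ (placed-inside⇒InCol b∈ placement′)) ,
    placed-beside⇒¬InCol placement ∘ proj₁ ,
    mk⇔ (const q≡q′)
        (const (inj₂ (placed-inside⇒InCol b∈ placement′ , placed-beside⇒InNbrCols a∈ placement)))
  Covering⇒Criterion a∈ b∈ placement@(beside _) placement′@(beside _) q≢q′ =
    (inj₁ (placed-beside⇒InNbrCols a∈ placement) , inj₁ (placed-beside⇒InNbrCols b∈ placement′)) ,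
    placed-beside⇒¬InCol placement ∘ proj₁ ,
    mk⇔ (⊥-elim ∘ [ placed-beside⇒¬InCol placement ∘ proj₁ , placed-beside⇒¬InCol placement′ ∘ proj₁ ])
        (⊥-elim ∘ q≢q′)
  Covering⇒Criterion _ _ (inside _)    (inside _)    ()
  Covering⇒Criterion _ _ (inside _)    (outside _ _) ()
  Covering⇒Criterion _ _ (beside _)    (outside _ _) ()
  Covering⇒Criterion _ _ (outside _ _) _             ()

  Criterion⇔Covering : ∀ {m p q p′ q′ s s′} → IsVertex n m (p , q) → IsVertex n m (p′ , q′) →
                       Placed p s → Placed p′ s′ →
                       Criterion G n m i (p , q) (p′ , q′) ⇔ Covering s s′ q q′
  Criterion⇔Covering a∈ b∈ placement placement′ =
    mk⇔ (Criterion⇒Covering a∈ b∈ placement placement′) (Covering⇒Criterion a∈ b∈ placement placement′)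

lemma3p2 : (G : Kind) (n m : ℕ) → 3 ≤ m → 2 ≤ n →
    (i : ℕ) → 1 ≤ i → i ≤ n →
    (a b : Vertex) → IsVertex n m a → IsVertex n m b → a ≢ b →
    DominatesCol G n m a b i ⇔
      ((InCloseCols G n m i a × InCloseCols G n m i b)
        × ¬ (InCol G n m i a × InCol G n m i b)
      × (((InCol G n m i a × InNbrCols G n m i b) ⊎ (InCol G n m i b × InNbrCols G n m i a))
          ⇔ (proj₂ a ≡ proj₂ b)))
lemma3p2 G n m 3≤m 2≤n i 1≤i i≤n (p , q) (p′ , q′) a∈ b∈ _
  with s  , placement  ← Relative.placed G 2≤n 1≤i i≤n p
     | s′ , placement′ ← Relative.placed G 2≤n 1≤i i≤n p′ =
  ⇔-trans (DominatesCol⇔CoverAllRows a∈ b∈ placement placement′)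
  (⇔-trans (CoverAllRows⇔Covering 3≤m s s′ (proj₂ a∈) (proj₂ b∈))
           (⇔-sym (Criterion⇔Covering a∈ b∈ placement placement′)))
  where open Relative G 2≤n 1≤i i≤n
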